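{- For every graph $G$ on $n$ vertices, $\rho_{\widehat{T}}(G)\le n-\alpha(G)$. Furthermore, if $G$ is triangle-free, then $\rho_{\widehat{T}}(G)=n-\alpha(G)$.
   Context: Graphs are finite and simple. $\alpha(G)$ is the size of a largest independent set of $G$. For $u,v\in(\mathbb{R}\cup\{ -\infty\})^k$, $u\,\widehat{\odot}\,v=\max_i(u_i+v_i)$. $\rho_{\widehat{T}}(G)$ is the minimum $k$ such that there is $f:V(G)\to(\mathbb{R}\cup\{ -\infty\})^k$ and a threshold $t>0$ with, for all distinct $x,y$, $xy\in E(G)$ iff $f(x)\,\widehat{\odot}\,f(y)\ge t$.
   Formalization: The representations f take values in (ℚ∪{−∞})^k and the threshold t is rational, rather than in (ℝ∪{−∞})^k and ℝ. -}

module Defs where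

open import Data.Nat using (ℕ; _∸_; _≤_)
open import Data.Fin using (Fin)
open import Data.Fin.Subset using (Subset; _∈_; ∣_∣)
open import Data.Bool using (Bool; true; false)
open import Data.Maybe using (Maybe; just; nothing)
open import Data.Rational as ℚ using (ℚ; 0ℚ)
open import Data.Product using (Σ; _×_; ∃)
open import Data.Empty using (⊥)
open import Relation.Nullary using (¬_)
open import Relation.Binary.PropositionalEquality using (_≡_; _≢_)
open import Function.Bundles using (_⇔_)

record Graph (n : ℕ) : Set where
  field
    adj    : Fin n → Fin n → Bool
    sym    : ∀ i j → adj i j ≡ adj j i
    irrefl : ∀ i → adj i i ≡ false
open Graph public

Edge : ∀ {n} → Graph n → Fin n → Fin n → Set
Edge G i j = adj G i j ≡ true

IsIndependent : ∀ {n} → Graph n → Subset n → Set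
IsIndependent G S = ∀ i j → i ∈ S → j ∈ S → ¬ Edge G i j

IsIndependenceNumber : ∀ {n} → Graph n → ℕ → Set
IsIndependenceNumber G a =
  (Σ (Subset _) λ S → IsIndependent G S × ∣ S ∣ ≡ a)
  × (∀ S → IsIndependent G S → ∣ S ∣ ≤ a)

TriangleFree : ∀ {n} → Graph n → Set
TriangleFree G = ∀ i j k → Edge G i j → Edge G j k → Edge G i k → ⊥

-- ℚ ∪ {-∞}, with nothing = -∞
ℚ∞ : Set
ℚ∞ = Maybe ℚ

_+∞_ : ℚ∞ → ℚ∞ → ℚ∞
just x +∞ just y = just (x ℚ.+ y)
_ +∞ _ = nothing

max∞ : ℚ∞ → ℚ∞ → ℚ∞
max∞ nothing y = y
max∞ (just x) nothing = just x
max∞ (just x) (just y) = just (x ℚ.⊔ y)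

maxPlusDot : ∀ {k : ℕ} → (Fin k → ℚ∞) → (Fin k → ℚ∞) → ℚ∞
maxPlusDot {ℕ.zero} u v = nothing
maxPlusDot {ℕ.suc k} u v =
  max∞ (u Fin.zero +∞ v Fin.zero) (maxPlusDot (λ i → u (Fin.suc i)) (λ i → v (Fin.suc i)))
  where import Data.Fin as Fin

_≥∞_ : ℚ∞ → ℚ → Set
nothing ≥∞ t = ⊥
just x ≥∞ t = t ℚ.≤ x

HasTropRep : ∀ {n} → Graph n → ℕ → Set
HasTropRep {n} G k =
  Σ (Fin n → Fin k → ℚ∞) λ f → Σ ℚ λ t → (0ℚ ℚ.< t) ×
    (∀ x y → x ≢ y → (Edge G x y ⇔ (maxPlusDot (f x) (f y) ≥∞ t)))

{-# OPTIONS --safe #-}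
-- Both bounds go through vertex covers, whose minimum size is n − α(G) since
-- complements of independent sets are exactly the vertex covers.
-- Upper bound: give each vertex c of a cover its own coordinate, equal to 1 at c,
-- 0 at the neighbours of c and −∞ elsewhere. With threshold 1 a coordinate fires
-- on a pair only if one of them is c and the other a neighbour (as 0 + 0 < 1),
-- so the coordinates together fire exactly on the edges.
-- Lower bound: in a threshold representation, let m be a vertex maximising
-- coordinate i. If the edge xy fires at i and m ∉ {x, y}, then replacing x or y
-- by m keeps the sum above the threshold, so xm and ym are edges and xym is a
-- triangle. Hence in a triangle-free graph the maximisers of the k coordinates
-- form a vertex cover, and n − α(G) ≤ k.
module Submission where

open import Defs
open import Data.Nat using (ℕ; _∸_; _≤_)
open import Data.Product using (Σ; _×_)

open import Data.Bool using (true; false; if_then_else_)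
open import Data.Empty using (⊥-elim)
open import Data.Fin using (Fin; zero; suc; _≟_)
open import Data.Fin.Subset
  using (Subset; inside; outside; ⊥; ⁅_⁆; _∪_; ∁; ∣_∣; _∈_)
open import Data.Fin.Subset.Properties
  using (_∈?_; ∣⊥∣≡0; ∣⁅x⁆∣≡1; ∣∁p∣≡n∸∣p∣; x∈⁅x⁆; x∈p∪q⁺; x∈∁p⇒x∉p; x∉p⇒x∈∁p)
open import Data.List using (allFin)
open import Data.List.Membership.Propositional.Properties using (∈-allFin)
import Data.List.Relation.Unary.All as All
open import Data.Maybe using (just; nothing)
open import Data.Nat using (_+_; z≤n; s≤s)
open import Data.Nat.Properties
  using (≤-refl; ≤-trans; ≤-reflexive; +-suc; +-comm; +-monoʳ-≤; n≤1+n; m≤n+m∸n; m≤n+o⇒m∸n≤o; module ≤-Reasoning)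
open import Data.Product using (_,_; ∃; map; map₂)
open import Data.Rational as ℚ using (ℚ; 0ℚ; 1ℚ)
import Data.Rational.Properties as ℚ
open import Data.Sum using (_⊎_; inj₁; inj₂; [_,_]′)
open import Data.Vec using ([]; _∷_; here; there)
open import Function using (_∘_; _⇔_; mk⇔; Equivalence)
open import Level using (0ℓ)
open import Relation.Binary.Bundles using (TotalOrder)
open import Relation.Binary.Construct.Add.Infimum.NonStrict ℚ._≤_
  using (_≤₋_; [_]; ≤₋-isTotalOrder-≡)
open import Relation.Binary.PropositionalEquality as ≡ using (_≡_; _≢_; refl; cong)
open import Relation.Nullary using (yes; no)
open import Relation.Nullary.Decidable using (from-yes; from-no)

ℚ∞-totalOrder : TotalOrder 0ℓ 0ℓ 0ℓ
ℚ∞-totalOrder = record { isTotalOrder = ≤₋-isTotalOrder-≡ ℚ.≤-isTotalOrder }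

open import Data.List.Extrema ℚ∞-totalOrder using (argmax; f[xs]≤f[argmax])

max∞-≥∞⁻ : ∀ a b {t} → max∞ a b ≥∞ t → a ≥∞ t ⊎ b ≥∞ t
max∞-≥∞⁻ nothing  b        h = inj₂ h
max∞-≥∞⁻ (just x) nothing  h = inj₁ h
max∞-≥∞⁻ (just x) (just y) {t} h with ℚ.⊔-sel x y
... | inj₁ x⊔y≡x = inj₁ (≡.subst (t ℚ.≤_) x⊔y≡x h)
... | inj₂ x⊔y≡y = inj₂ (≡.subst (t ℚ.≤_) x⊔y≡y h)

max∞-≥∞⁺ˡ : ∀ a b {t} → a ≥∞ t → max∞ a b ≥∞ t
max∞-≥∞⁺ˡ (just x) nothing  h = h
max∞-≥∞⁺ˡ (just x) (just y) h = ℚ.p≤q⇒p≤q⊔r y h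

max∞-≥∞⁺ʳ : ∀ a b {t} → b ≥∞ t → max∞ a b ≥∞ t
max∞-≥∞⁺ʳ nothing  b        h = h
max∞-≥∞⁺ʳ (just x) (just y) h = ℚ.p≤q⇒p≤r⊔q x h

maxPlusDot-≥∞⁻ : ∀ {k} (u v : Fin k → ℚ∞) {t} →
                 maxPlusDot u v ≥∞ t → ∃ λ i → (u i +∞ v i) ≥∞ t
maxPlusDot-≥∞⁻ {ℕ.suc k} u v h with max∞-≥∞⁻ (u zero +∞ v zero) _ h
... | inj₁ h₀ = zero , h₀
... | inj₂ h₁ = let i , h₁ᵢ = maxPlusDot-≥∞⁻ (u ∘ suc) (v ∘ suc) h₁ in suc i , h₁ᵢ

maxPlusDot-≥∞⁺ : ∀ {k} {u v : Fin k → ℚ∞} {t} i →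
                 (u i +∞ v i) ≥∞ t → maxPlusDot u v ≥∞ t
maxPlusDot-≥∞⁺ zero    h = max∞-≥∞⁺ˡ _ _ h
maxPlusDot-≥∞⁺ (suc i) h = max∞-≥∞⁺ʳ _ _ (maxPlusDot-≥∞⁺ i h)

+∞-comm : ∀ u v → u +∞ v ≡ v +∞ u
+∞-comm (just x) (just y) = cong just (ℚ.+-comm x y)
+∞-comm (just x) nothing  = refl
+∞-comm nothing  (just y) = refl
+∞-comm nothing  nothing  = refl

+∞-monoˡ-≥∞ : ∀ {u u′ w t} → u ≤₋ u′ → (u +∞ w) ≥∞ t → (u′ +∞ w) ≥∞ t
+∞-monoˡ-≥∞ {w = just z}  [ x≤y ] h = ℚ.≤-trans h (ℚ.+-monoˡ-≤ z x≤y)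

+∞-monoʳ-≥∞ : ∀ {u u′ w t} → u ≤₋ u′ → (w +∞ u) ≥∞ t → (w +∞ u′) ≥∞ t
+∞-monoʳ-≥∞ {w = just z}  [ x≤y ] h = ℚ.≤-trans h (ℚ.+-monoʳ-≤ z x≤y)

argmax-maximal : ∀ {n} (g : Fin n → ℚ∞) x₀ y → g y ≤₋ g (argmax g x₀ (allFin n))
argmax-maximal g x₀ y = All.lookup (f[xs]≤f[argmax] {f = g} x₀ (allFin _)) (∈-allFin y)

∣p∪q∣≤∣p∣+∣q∣ : ∀ {n} (p q : Subset n) → ∣ p ∪ q ∣ ≤ ∣ p ∣ + ∣ q ∣
∣p∪q∣≤∣p∣+∣q∣ []            []            = z≤n
∣p∪q∣≤∣p∣+∣q∣ (outside ∷ p) (outside ∷ q) = ∣p∪q∣≤∣p∣+∣q∣ p q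
∣p∪q∣≤∣p∣+∣q∣ (inside  ∷ p) (outside ∷ q) = s≤s (∣p∪q∣≤∣p∣+∣q∣ p q)
∣p∪q∣≤∣p∣+∣q∣ (outside ∷ p) (inside  ∷ q) =
  ≤-trans (s≤s (∣p∪q∣≤∣p∣+∣q∣ p q)) (≤-reflexive (≡.sym (+-suc ∣ p ∣ ∣ q ∣)))
∣p∪q∣≤∣p∣+∣q∣ (inside  ∷ p) (inside  ∷ q) =
  s≤s (≤-trans (∣p∪q∣≤∣p∣+∣q∣ p q) (+-monoʳ-≤ ∣ p ∣ (n≤1+n ∣ q ∣)))

image : ∀ {n k} → (Fin k → Fin n) → Subset n
image {k = ℕ.zero}  v = ⊥
image {k = ℕ.suc k} v = ⁅ v zero ⁆ ∪ image (v ∘ suc)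

∈-image : ∀ {n k} (v : Fin k → Fin n) i → v i ∈ image v
∈-image v zero    = x∈p∪q⁺ (inj₁ (x∈⁅x⁆ (v zero)))
∈-image v (suc i) = x∈p∪q⁺ {p = ⁅ v zero ⁆} (inj₂ (∈-image (v ∘ suc) i))

∣image∣≤ : ∀ {n k} (v : Fin k → Fin n) → ∣ image v ∣ ≤ k
∣image∣≤ {n} {ℕ.zero}  v = ≤-reflexive (∣⊥∣≡0 n)
∣image∣≤ {n} {ℕ.suc k} v = begin
  ∣ ⁅ v zero ⁆ ∪ image (v ∘ suc) ∣       ≤⟨ ∣p∪q∣≤∣p∣+∣q∣ ⁅ v zero ⁆ (image (v ∘ suc)) ⟩
  ∣ ⁅ v zero ⁆ ∣ + ∣ image (v ∘ suc) ∣   ≡⟨ cong (_+ ∣ image (v ∘ suc) ∣) (∣⁅x⁆∣≡1 (v zero)) ⟩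
  ℕ.suc ∣ image (v ∘ suc) ∣              ≤⟨ s≤s (∣image∣≤ (v ∘ suc)) ⟩
  ℕ.suc k                                ∎
  where open ≤-Reasoning

enumerate : ∀ {n} (p : Subset n) → Fin ∣ p ∣ → Fin n
enumerate (inside  ∷ p) zero    = zero
enumerate (inside  ∷ p) (suc i) = suc (enumerate p i)
enumerate (outside ∷ p) i       = suc (enumerate p i)

enumerate-onto : ∀ {n} {p : Subset n} {x} → x ∈ p → ∃ λ i → enumerate p i ≡ x
enumerate-onto {p = inside  ∷ p} here        = zero , refl
enumerate-onto {p = inside  ∷ p} (there x∈p) = map suc (cong suc) (enumerate-onto x∈p)
enumerate-onto {p = outside ∷ p} (there x∈p) = map₂ (cong suc) (enumerate-onto x∈p)

m∸n≤o⇒m∸o≤n : ∀ m n o → m ∸ n ≤ o → m ∸ o ≤ n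
m∸n≤o⇒m∸o≤n m n o h = m≤n+o⇒m∸n≤o m o (begin
  m            ≤⟨ m≤n+m∸n m n ⟩
  n + (m ∸ n)  ≤⟨ +-monoʳ-≤ n h ⟩
  n + o        ≡⟨ +-comm n o ⟩
  o + n        ∎)
  where open ≤-Reasoning

module _ {n} (G : Graph n) where

  IsVertexCover : Subset n → Set
  IsVertexCover C = ∀ x y → Edge G x y → x ∈ C ⊎ y ∈ C

  IsThresholdRep : ∀ {k} → (Fin n → Fin k → ℚ∞) → ℚ → Set
  IsThresholdRep f t = ∀ x y → x ≢ y → (Edge G x y ⇔ (maxPlusDot (f x) (f y) ≥∞ t))

module _ {n} (G : Graph n) where

  edge-sym : ∀ {x y} → Edge G x y → Edge G y x
  edge-sym {x} {y} e = ≡.trans (sym G y x) e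

  edge⇒≢ : ∀ {x y} → Edge G x y → x ≢ y
  edge⇒≢ {x} e refl with ≡.trans (≡.sym e) (irrefl G x)
  ... | ()

  ∁-independent⇒vertexCover : ∀ {S} → IsIndependent G S → IsVertexCover G (∁ S)
  ∁-independent⇒vertexCover {S} independent x y e with x ∈? S | y ∈? S
  ... | yes x∈S | yes y∈S = ⊥-elim (independent x y x∈S y∈S e)
  ... | no x∉S  | _       = inj₁ (x∉p⇒x∈∁p x∉S)
  ... | _       | no y∉S  = inj₂ (x∉p⇒x∈∁p y∉S)

  ∁-vertexCover⇒independent : ∀ {C} → IsVertexCover G C → IsIndependent G (∁ C)
  ∁-vertexCover⇒independent cover x y x∈∁C y∈∁C e =
    [ x∈∁p⇒x∉p x∈∁C , x∈∁p⇒x∉p y∈∁C ]′ (cover x y e)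

  n∸α≤∣vertexCover∣ : ∀ {a C} → IsIndependenceNumber G a → IsVertexCover G C → n ∸ a ≤ ∣ C ∣
  n∸α≤∣vertexCover∣ {a} {C} (_ , maximal) cover = m∸n≤o⇒m∸o≤n n ∣ C ∣ a (begin
    n ∸ ∣ C ∣  ≡⟨ ≡.sym (∣∁p∣≡n∸∣p∣ C) ⟩
    ∣ ∁ C ∣    ≤⟨ maximal (∁ C) (∁-vertexCover⇒independent cover) ⟩
    a          ∎)
    where open ≤-Reasoning

  star : Fin n → Fin n → ℚ∞
  star c x with x ≟ c
  ... | yes _ = just 1ℚ
  ... | no  _ = if adj G c x then just 0ℚ else nothing

  star-fires⇒edge : ∀ {c x y} → x ≢ y → (star c x +∞ star c y) ≥∞ 1ℚ → Edge G x y
  star-fires⇒edge {c} {x} {y} x≢y fires with x ≟ c | y ≟ c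
  ... | yes refl | yes refl = ⊥-elim (x≢y refl)
  ... | yes refl | no _ with adj G x y
  ...   | true  = refl
  ...   | false = ⊥-elim fires
  star-fires⇒edge {c} {x} {y} x≢y fires | no _ | yes refl with adj G y x | sym G x y
  ...   | true  | xy≡yx = xy≡yx
  ...   | false | _     = ⊥-elim fires
  star-fires⇒edge {c} {x} {y} x≢y fires | no _ | no _ with adj G c x | adj G c y
  ...   | true  | true  = ⊥-elim (from-no (1ℚ ℚ.≤? 0ℚ ℚ.+ 0ℚ) fires)
  ...   | true  | false = ⊥-elim fires
  ...   | false | _     = ⊥-elim fires

  edge⇒star-fires : ∀ {c y} → Edge G c y → (star c c +∞ star c y) ≥∞ 1ℚ
  edge⇒star-fires {c} {y} e with c ≟ c | y ≟ c
  ... | no c≢c | _        = ⊥-elim (c≢c refl)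
  ... | yes _  | yes refl = ⊥-elim (edge⇒≢ e refl)
  ... | yes _  | no _ rewrite e = from-yes (1ℚ ℚ.≤? 1ℚ ℚ.+ 0ℚ)

  vertexCover⇒tropRep : ∀ {C} → IsVertexCover G C → HasTropRep G ∣ C ∣
  vertexCover⇒tropRep {C} cover =
    f , 1ℚ , from-yes (0ℚ ℚ.<? 1ℚ) , λ x y x≢y → mk⇔ (edge⇒fires x≢y) (fires⇒edge x≢y)
    where
    f : Fin n → Fin ∣ C ∣ → ℚ∞
    f x i = star (enumerate C i) x

    fires⇒edge : ∀ {x y} → x ≢ y → maxPlusDot (f x) (f y) ≥∞ 1ℚ → Edge G x y
    fires⇒edge {x} {y} x≢y fires =
      let i , fires-at-i = maxPlusDot-≥∞⁻ (f x) (f y) fires in star-fires⇒edge x≢y fires-at-i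

    edge⇒fires : ∀ {x y} → x ≢ y → Edge G x y → maxPlusDot (f x) (f y) ≥∞ 1ℚ
    edge⇒fires {x} {y} x≢y e with cover x y e
    ... | inj₁ x∈C with enumerate-onto x∈C
    ...   | i , refl = maxPlusDot-≥∞⁺ i (edge⇒star-fires e)
    edge⇒fires {x} {y} x≢y e | inj₂ y∈C with enumerate-onto y∈C
    ...   | i , refl = maxPlusDot-≥∞⁺ i
            (≡.subst (_≥∞ 1ℚ) (+∞-comm (f y i) (f x i)) (edge⇒star-fires (edge-sym e)))

firing-pair∋maximiser : ∀ {n k} (G : Graph n) → TriangleFree G →
                        ∀ {f : Fin n → Fin k → ℚ∞} {t} → IsThresholdRep G f t →
                        ∀ {x y m} i → x ≢ y → (f x i +∞ f y i) ≥∞ t →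
                        (∀ z → f z i ≤₋ f m i) → m ≡ x ⊎ m ≡ y
firing-pair∋maximiser G triangleFree {f} {t} represents {x} {y} {m} i x≢y fires maximal
  with m ≟ x | m ≟ y
... | yes m≡x | _       = inj₁ m≡x
... | no _    | yes m≡y = inj₂ m≡y
... | no m≢x  | no m≢y  = ⊥-elim (triangleFree x y m xy ym xm)
  where
  fires⇒edge : ∀ {u v} → u ≢ v → (f u i +∞ f v i) ≥∞ t → Edge G u v
  fires⇒edge {u} {v} u≢v h = Equivalence.from (represents u v u≢v) (maxPlusDot-≥∞⁺ i h)

  xy : Edge G x y
  xy = fires⇒edge x≢y fires
  xm : Edge G x m
  xm = fires⇒edge (m≢x ∘ ≡.sym) (+∞-monoʳ-≥∞ (maximal y) fires)
  ym : Edge G y m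
  ym = fires⇒edge (m≢y ∘ ≡.sym)
         (≡.subst (_≥∞ t) (+∞-comm (f m i) (f y i)) (+∞-monoˡ-≥∞ (maximal x) fires))

tropRep⇒vertexCover : ∀ {n k} (G : Graph n) → TriangleFree G → HasTropRep G k →
                      Σ (Subset n) λ C → IsVertexCover G C × ∣ C ∣ ≤ k
tropRep⇒vertexCover {ℕ.zero}      _ _            _                       = [] , (λ ()) , z≤n
tropRep⇒vertexCover {ℕ.suc m} {k} G triangleFree (f , t , _ , represents) =
  image maximiser , cover , ∣image∣≤ maximiser
  where
  maximiser : Fin k → Fin (ℕ.suc m)
  maximiser i = argmax (λ x → f x i) zero (allFin _)

  cover : IsVertexCover G (image maximiser)
  cover x y e with maxPlusDot-≥∞⁻ (f x) (f y) (Equivalence.to (represents x y (edge⇒≢ G e)) e)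
  ... | i , fires with firing-pair∋maximiser G triangleFree represents i (edge⇒≢ G e) fires
                         (argmax-maximal (λ z → f z i) zero)
  ...   | inj₁ refl = inj₁ (∈-image maximiser i)
  ...   | inj₂ refl = inj₂ (∈-image maximiser i)

mainTheorem10 : ∀ (n : ℕ) (G : Graph n) (a : ℕ) → IsIndependenceNumber G a →
    (Σ ℕ λ k → k ≤ n ∸ a × HasTropRep G k)
    × (TriangleFree G → HasTropRep G (n ∸ a) × (∀ k → HasTropRep G k → n ∸ a ≤ k))
mainTheorem10 n G a α@((S , S-independent , ∣S∣≡a) , _) =
  (n ∸ a , ≤-refl , upper) , λ triangleFree → upper , lower triangleFree
  where
  ∣∁S∣≡n∸a : ∣ ∁ S ∣ ≡ n ∸ a
  ∣∁S∣≡n∸a = ≡.trans (∣∁p∣≡n∸∣p∣ S) (cong (n ∸_) ∣S∣≡a)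

  upper : HasTropRep G (n ∸ a)
  upper = ≡.subst (HasTropRep G) ∣∁S∣≡n∸a
            (vertexCover⇒tropRep G (∁-independent⇒vertexCover G S-independent))

  lower : TriangleFree G → ∀ k → HasTropRep G k → n ∸ a ≤ k
  lower triangleFree k ρ =
    let C , cover , ∣C∣≤k = tropRep⇒vertexCover G triangleFree ρ
    in ≤-trans (n∸α≤∣vertexCover∣ G α cover) ∣C∣≤k
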